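{- Let $G$ be a digraph and let $G'$ be a spanning subgraph of $G$ that is not a multipath. Then $G'$ is minimal by inclusion among spanning subgraphs of $G$ that are not multipaths if and only if $G'$ is the disjoint union of some isolated vertices with exactly one of the following: (1) a linear sink or a linear source, or (2) a coherently oriented cycle (possibly a loop).
   Context: Digraphs: finite vertex and edge sets, at most one edge $(v,w)$ from $v$ to $w$ for distinct $v,w$, finitely many loops (edges with equal source and target) allowed at each vertex. A simple path is a sequence of non-loop edges $e_1,\dots,e_n$ with target of $e_i$ = source of $e_{i+1}$, no vertex encountered twice, and source of $e_1\neq$ target of $e_n$. A multipath of $G$ is a spanning subgraph each of whose connected components is a single vertex or a simple path. A linear sink is a digraph with three distinct vertices $v_0,v_1,v_2$ and edges $(v_0,v_1),(v_2,v_1)$; a linear source has edges $(v_1,v_0),(v_1,v_2)$. A coherently oriented cycle is either a single loop or a digraph with distinct vertices $v_1,\dots,v_n$ ($n\ge2$) and edges $(v_1,v_2),\dots,(v_{n-1},v_n),(v_n,v_1)$. -}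

module Defs where

open import Data.Nat using (ℕ; zero; suc)
open import Data.Fin using (Fin; zero; suc; inject₁; fromℕ)
open import Data.Fin.Subset using (Subset; _∈_; _⊆_)
open import Data.Product using (Σ; ∃; _×_; _,_)
open import Data.Sum using (_⊎_)
open import Relation.Nullary using (¬_)
open import Relation.Binary.PropositionalEquality using (_≡_; _≢_)
open import Function.Definitions using (Injective)

record Digraph : Set where
  field
    n m : ℕ
    src tgt : Fin m → Fin n
    atMostOne : ∀ e f → src e ≢ tgt e → src e ≡ src f → tgt e ≡ tgt f → e ≡ f

-- A spanning subgraph of G is given by its set of edges (all vertices kept).
SpanningSubgraph : Digraph → Set
SpanningSubgraph G = Subset (Digraph.m G)

module _ (G : Digraph) where
  open Digraph G

  data Conn (H : Subset m) (v : Fin n) : Fin n → Set where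
    here : Conn H v v
    fwd  : ∀ {u} e → e ∈ H → Conn H v (src e) → tgt e ≡ u → Conn H v u
    bwd  : ∀ {u} e → e ∈ H → Conn H v (tgt e) → src e ≡ u → Conn H v u

  pathVert : ∀ {len} → (Fin (suc len) → Fin m) → Fin (suc (suc len)) → Fin n
  pathVert edge zero    = src (edge zero)
  pathVert edge (suc i) = tgt (edge i)

  -- A simple path in H with (suc len) ≥ 1 edges e₀ … e_len.
  record SimplePath (H : Subset m) : Set where
    field
      len   : ℕ
      edge  : Fin (suc len) → Fin m
      inH   : ∀ i → edge i ∈ H
      nonLoop : ∀ i → src (edge i) ≢ tgt (edge i)
      consec  : ∀ (i : Fin len) → tgt (edge (inject₁ i)) ≡ src (edge (suc i))
      noRepeat : Injective _≡_ _≡_ (pathVert edge)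
      endsDiffer : src (edge zero) ≢ tgt (edge (fromℕ len))
    vert : Fin (suc (suc len)) → Fin n
    vert = pathVert edge

  SingleVertexComponent : Subset m → Fin n → Set
  SingleVertexComponent H v = ∀ e → e ∈ H → (src e ≢ v) × (tgt e ≢ v)

  PathComponent : Subset m → Fin n → Set
  PathComponent H v = Σ (SimplePath H) λ P →
      (∀ w → Conn H v w → ∃ λ i → SimplePath.vert P i ≡ w)
    × (∀ i → Conn H v (SimplePath.vert P i))
    × (∀ e → e ∈ H → Conn H v (src e) → ∃ λ i → SimplePath.edge P i ≡ e)

  IsMultipath : Subset m → Set
  IsMultipath H = ∀ v → SingleVertexComponent H v ⊎ PathComponent H v

  MinimalNonMultipath : Subset m → Set
  MinimalNonMultipath H =
    ¬ IsMultipath H × (∀ H' → H' ⊆ H → ¬ IsMultipath H' → H ⊆ H')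

  IsLinearSinkPlusIsolated : Subset m → Set
  IsLinearSinkPlusIsolated H = ∃ λ v₀ → ∃ λ v₁ → ∃ λ v₂ → ∃ λ a → ∃ λ b →
      v₀ ≢ v₁ × v₁ ≢ v₂ × v₀ ≢ v₂
    × src a ≡ v₀ × tgt a ≡ v₁ × src b ≡ v₂ × tgt b ≡ v₁
    × a ∈ H × b ∈ H × (∀ e → e ∈ H → e ≡ a ⊎ e ≡ b)

  IsLinearSourcePlusIsolated : Subset m → Set
  IsLinearSourcePlusIsolated H = ∃ λ v₀ → ∃ λ v₁ → ∃ λ v₂ → ∃ λ a → ∃ λ b →
      v₀ ≢ v₁ × v₁ ≢ v₂ × v₀ ≢ v₂
    × src a ≡ v₁ × tgt a ≡ v₀ × src b ≡ v₁ × tgt b ≡ v₂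
    × a ∈ H × b ∈ H × (∀ e → e ∈ H → e ≡ a ⊎ e ≡ b)

  -- Edge set of H is exactly a coherently oriented cycle: either one loop,
  -- or distinct v₀ … v_{k+1} (k+2 ≥ 2 vertices) with edges
  -- vᵢ → vᵢ₊₁ (i ≤ k) and the closing edge v_{k+1} → v₀.
  IsCoherentCyclePlusIsolated : Subset m → Set
  IsCoherentCyclePlusIsolated H =
      (∃ λ ℓ → src ℓ ≡ tgt ℓ × ℓ ∈ H × (∀ e → e ∈ H → e ≡ ℓ))
    ⊎ (∃ λ k → Σ (Fin (suc (suc k)) → Fin n) λ v → Σ (Fin (suc k) → Fin m) λ p → ∃ λ c →
          Injective _≡_ _≡_ v
        × (∀ i → src (p i) ≡ v (inject₁ i) × tgt (p i) ≡ v (suc i) × p i ∈ H)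
        × src c ≡ v (fromℕ (suc k)) × tgt c ≡ v zero × c ∈ H
        × (∀ e → e ∈ H → (∃ λ i → p i ≡ e) ⊎ e ≡ c))

-- An edge set H is a multipath exactly when every vertex has in- and out-degree at most 1 in H
-- and H has no directed cycle, i.e. no nonempty predecessor-closed subset (loops included); the
-- harder direction is an induction that prepends an edge without predecessor to a path.
-- In a minimal non-multipath H, a loop, two edges with a common target, or two with a common
-- source already form a non-multipath, so H consists of exactly them. Otherwise H is
-- predecessor-closed, and for any edge e of H the multipath H - e contains a path from tgt e to
-- src e that e closes into a coherent cycle. Conversely, every proper subgraph of a linear
-- sink, a linear source or a coherent cycle satisfies the degree and acyclicity conditions.

module Submission where

open import Defs
open import Data.Sum using (_⊎_)
open import Relation.Nullary using (¬_)
open import Function.Bundles using (_⇔_)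

open import Data.Nat using (zero; suc)
open import Data.Fin using (Fin; zero; suc; inject₁; fromℕ; _≟_)
open import Data.Fin.Properties using (any?; 0≢1+n; suc-injective; inject₁-injective; fromℕ≢inject₁)
open import Data.Fin.Induction using (<-weakInduction; >-weakInduction)
open import Data.Fin.Subset
  using (Subset; _∈_; _∉_; _⊆_; _⊂_; _─_; _-_; _∪_; ⁅_⁆; Nonempty; Empty; outside)
open import Data.Fin.Subset.Properties
  using (_∈?_; nonempty?; x∈⁅x⁆; x∈⁅y⁆⇒x≡y; x∈p∪q⁺; x∈p∪q⁻; x∈p∧x≢y⇒x∈p-y; p─q⊆p; x∈p⇒p-x⊂p)
open import Data.Fin.Subset.Induction using (⊂-wellFounded)
open import Data.Vec using (_∷_; here; there; tabulate)
open import Data.Vec.Properties using (lookup∘tabulate; lookup⇒[]=; []=⇒lookup)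
import Data.Vec.Functional as Vector
open import Data.Product using (∃; ∃₂; _×_; _,_; proj₁; proj₂)
open import Data.Sum using (inj₁; inj₂)
import Data.Sum as Sum
open import Induction.WellFounded using (Acc; acc)
open import Relation.Nullary using (Dec; yes; no; does; proof; contradiction)
open import Relation.Nullary.Reflects using (Reflects; invert)
open import Relation.Nullary.Decidable using (dec-true; decidable-stable; _×-dec_; ¬?)
open import Function.Definitions using (Injective)
open import Relation.Binary.PropositionalEquality using (_≡_; _≢_; refl; sym; trans; cong; subst)
open import Function.Bundles using (mk⇔)

x∈p─q⇒x∉q : ∀ {n} {p q : Subset n} {x} → x ∈ p ─ q → x ∉ q
x∈p─q⇒x∉q {p = _ ∷ _} {outside ∷ _} here        ()
x∈p─q⇒x∉q {p = _ ∷ _} {_ ∷ _}       (there x∈) (there x∈q) = x∈p─q⇒x∉q x∈ x∈q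

x∈p-y⇒x≢y : ∀ {n} {p : Subset n} {x y} → x ∈ p - y → x ≢ y
x∈p-y⇒x≢y x∈ refl = x∈p─q⇒x∉q x∈ (x∈⁅x⁆ _)

p-x⊆p : ∀ {n} {p : Subset n} {x} → p - x ⊆ p
p-x⊆p {p = p} {x} = p─q⊆p p ⁅ x ⁆

∈-⁅⁆∪⁅⁆⁻ : ∀ {n} {a b x : Fin n} → x ∈ ⁅ a ⁆ ∪ ⁅ b ⁆ → x ≡ a ⊎ x ≡ b
∈-⁅⁆∪⁅⁆⁻ {a = a} {b} x∈ = Sum.map (x∈⁅y⁆⇒x≡y a) (x∈⁅y⁆⇒x≡y b) (x∈p∪q⁻ ⁅ a ⁆ ⁅ b ⁆ x∈)

⁅⁆⊆ : ∀ {n} {a : Fin n} {p} → a ∈ p → ⁅ a ⁆ ⊆ p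
⁅⁆⊆ {a = a} a∈ x∈ with refl ← x∈⁅y⁆⇒x≡y a x∈ = a∈

x∈⁅x⁆∪⁅y⁆ : ∀ {n} (x y : Fin n) → x ∈ ⁅ x ⁆ ∪ ⁅ y ⁆
x∈⁅x⁆∪⁅y⁆ x y = x∈p∪q⁺ (inj₁ (x∈⁅x⁆ x))

y∈⁅x⁆∪⁅y⁆ : ∀ {n} (x y : Fin n) → y ∈ ⁅ x ⁆ ∪ ⁅ y ⁆
y∈⁅x⁆∪⁅y⁆ x y = x∈p∪q⁺ (inj₂ (x∈⁅x⁆ y))

⁅⁆∪⁅⁆⊆ : ∀ {n} {a b : Fin n} {p} → a ∈ p → b ∈ p → ⁅ a ⁆ ∪ ⁅ b ⁆ ⊆ p
⁅⁆∪⁅⁆⊆ a∈ b∈ x∈ with ∈-⁅⁆∪⁅⁆⁻ x∈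
... | inj₁ refl = a∈
... | inj₂ refl = b∈

image : ∀ {k n} → (Fin k → Fin n) → Subset n
image f = tabulate λ x → does (any? λ i → f i ≟ x)

f∈image : ∀ {k n} (f : Fin k → Fin n) i → f i ∈ image f
f∈image f i =
  lookup⇒[]= (f i) (image f) (trans (lookup∘tabulate _ (f i)) (dec-true (any? _) (i , refl)))

∈-image⁻ : ∀ {k n} (f : Fin k → Fin n) {x} → x ∈ image f → ∃ λ i → f i ≡ x
∈-image⁻ f {x} x∈ = invert (subst (Reflects _) does≡true (proof (any? λ i → f i ≟ x)))
  where does≡true = trans (sym (lookup∘tabulate _ x)) ([]=⇒lookup x∈)

fromℕ⊎inject₁ : ∀ {n} (i : Fin (suc n)) → i ≡ fromℕ n ⊎ ∃ λ j → i ≡ inject₁ j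
fromℕ⊎inject₁ {zero}  zero    = inj₁ refl
fromℕ⊎inject₁ {suc n} zero    = inj₂ (zero , refl)
fromℕ⊎inject₁ {suc n} (suc i) =
  Sum.map (cong suc) (λ (j , i≡j) → suc j , cong suc i≡j) (fromℕ⊎inject₁ i)

InjectiveOn : ∀ {k n} → Subset k → (Fin k → Fin n) → Set
InjectiveOn p φ = ∀ a b → a ∈ p → b ∈ p → φ a ≡ φ b → a ≡ b

InjectiveOn-antimono : ∀ {k n} {p q : Subset k} {φ : Fin k → Fin n} →
                       p ⊆ q → InjectiveOn q φ → InjectiveOn p φ
InjectiveOn-antimono p⊆q inj a b a∈ b∈ = inj a b (p⊆q a∈) (p⊆q b∈)

injectiveOn⊎collision : ∀ {k n} (p : Subset k) (φ : Fin k → Fin n) →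
  InjectiveOn p φ ⊎ ∃₂ λ a b → a ∈ p × b ∈ p × a ≢ b × φ a ≡ φ b
injectiveOn⊎collision p φ
  with any? (λ a → any? λ b → a ∈? p ×-dec b ∈? p ×-dec ¬? (a ≟ b) ×-dec φ a ≟ φ b)
... | yes (a , b , collision) = inj₂ (a , b , collision)
... | no noCollision = inj₁ λ a b a∈ b∈ φa≡φb →
  decidable-stable (a ≟ b) λ a≢b → noCollision (a , b , a∈ , b∈ , a≢b , φa≡φb)

module _ (G : Digraph) where
  open Digraph G
  open SimplePath

  private variable
    H H' S : Subset m
    v x y : Fin n

  Conn-trans : Conn G H v x → Conn G H x y → Conn G H v y
  Conn-trans p here                = p
  Conn-trans p (fwd e e∈ q tgt≡x) = fwd e e∈ (Conn-trans p q) tgt≡x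
  Conn-trans p (bwd e e∈ q src≡x) = bwd e e∈ (Conn-trans p q) src≡x

  Conn-sym : Conn G H v x → Conn G H x v
  Conn-sym here               = here
  Conn-sym (fwd e e∈ c refl) = Conn-trans (bwd e e∈ here refl) (Conn-sym c)
  Conn-sym (bwd e e∈ c refl) = Conn-trans (fwd e e∈ here refl) (Conn-sym c)

  Conn-mono : H ⊆ H' → Conn G H v x → Conn G H' v x
  Conn-mono H⊆H' here               = here
  Conn-mono H⊆H' (fwd e e∈ c tgt≡x) = fwd e (H⊆H' e∈) (Conn-mono H⊆H' c) tgt≡x
  Conn-mono H⊆H' (bwd e e∈ c src≡x) = bwd e (H⊆H' e∈) (Conn-mono H⊆H' c) src≡x

  isolated-Conn⇒≡ : SingleVertexComponent G H v → Conn G H v x → v ≡ x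
  isolated-Conn⇒≡ isolated here = refl
  isolated-Conn⇒≡ isolated (fwd e e∈ c refl) =
    contradiction (sym (isolated-Conn⇒≡ isolated c)) (proj₁ (isolated e e∈))
  isolated-Conn⇒≡ isolated (bwd e e∈ c refl) =
    contradiction (sym (isolated-Conn⇒≡ isolated c)) (proj₂ (isolated e e∈))

  src-edge : (P : SimplePath G H) (i : Fin (suc (len P))) → src (edge P i) ≡ vert P (inject₁ i)
  src-edge P zero    = refl
  src-edge P (suc i) = sym (consec P i)

  SimplePath-mono : H ⊆ H' → SimplePath G H → SimplePath G H'
  SimplePath-mono H⊆H' P = record
    { len = len P ; edge = edge P ; inH = λ i → H⊆H' (inH P i) ; nonLoop = nonLoop P
    ; consec = consec P ; noRepeat = noRepeat P ; endsDiffer = endsDiffer P }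

  edgePath : ∀ {e} → e ∈ H → src e ≢ tgt e → SimplePath G H
  edgePath {e = e} e∈ nonLoop-e = record
    { len = 0 ; edge = λ _ → e ; inH = λ _ → e∈ ; nonLoop = λ _ → nonLoop-e
    ; consec = λ () ; noRepeat = noRepeat-e ; endsDiffer = nonLoop-e }
    where
    noRepeat-e : ∀ {i j} → pathVert G (λ _ → e) i ≡ pathVert G (λ _ → e) j → i ≡ j
    noRepeat-e {zero}     {zero}     _  = refl
    noRepeat-e {zero}     {suc zero} eq = contradiction eq nonLoop-e
    noRepeat-e {suc zero} {zero}     eq = contradiction (sym eq) nonLoop-e
    noRepeat-e {suc zero} {suc zero} _  = refl

  module _ (P : SimplePath G H) {e} (e∈ : e ∈ H) (e↦start : tgt e ≡ vert P zero)
           (src-e∉P : ∀ i → vert P i ≢ src e) where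

    private
      E : Fin (suc (suc (len P))) → Fin m
      E = e Vector.∷ edge P

    vert-consPath : ∀ i → pathVert G E (suc i) ≡ vert P i
    vert-consPath zero    = e↦start
    vert-consPath (suc i) = refl

    consPath : SimplePath G H
    consPath = record
      { len = suc (len P) ; edge = E ; inH = inH⁺ ; nonLoop = nonLoop⁺
      ; consec = consec⁺ ; noRepeat = noRepeat⁺
      ; endsDiffer = λ eq → src-e∉P (suc (fromℕ (len P))) (sym eq) }
      where
      inH⁺ : ∀ i → E i ∈ H
      inH⁺ zero    = e∈
      inH⁺ (suc i) = inH P i
      nonLoop⁺ : ∀ i → src (E i) ≢ tgt (E i)
      nonLoop⁺ zero    eq = src-e∉P zero (sym (trans eq e↦start))
      nonLoop⁺ (suc i)    = nonLoop P i
      consec⁺ : ∀ i → tgt (E (inject₁ i)) ≡ src (E (suc i))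
      consec⁺ zero    = e↦start
      consec⁺ (suc i) = consec P i
      noRepeat⁺ : ∀ {i j} → pathVert G E i ≡ pathVert G E j → i ≡ j
      noRepeat⁺ {zero}  {zero}  _  = refl
      noRepeat⁺ {zero}  {suc j} eq = contradiction (sym (trans eq (vert-consPath j))) (src-e∉P j)
      noRepeat⁺ {suc i} {zero}  eq = contradiction (trans (sym (vert-consPath i)) eq) (src-e∉P i)
      noRepeat⁺ {suc i} {suc j} eq =
        cong suc (noRepeat P (trans (sym (vert-consPath i)) (trans eq (vert-consPath j))))

  PathComponent-transport : Conn G H v x → PathComponent G H v → PathComponent G H x
  PathComponent-transport v~x (P , covers , connected , edges) =
      P
    , (λ y c → covers y (Conn-trans v~x c))
    , (λ i → Conn-trans (Conn-sym v~x) (connected i))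
    , (λ e e∈ c → edges e e∈ (Conn-trans v~x c))

  no-edge-into-start : ((P , _) : PathComponent G H v) → ∀ h → h ∈ H → tgt h ≢ vert P zero
  no-edge-into-start (P , _ , connected , edges) h h∈ h↦start
    with edges h h∈ (bwd h h∈ (subst (Conn G _ _) (sym h↦start) (connected zero)) refl)
  ... | i , refl with noRepeat P {suc i} {zero} h↦start
  ... | ()

  src-component : IsMultipath G H → ∀ {e} → e ∈ H → PathComponent G H (src e)
  src-component mp {e} e∈ with mp (src e)
  ... | inj₁ isolated  = contradiction refl (proj₁ (isolated e e∈))
  ... | inj₂ component = component

  tgt-component : IsMultipath G H → ∀ {e} → e ∈ H → PathComponent G H (tgt e)
  tgt-component mp {e} e∈ with mp (tgt e)
  ... | inj₁ isolated  = contradiction refl (proj₂ (isolated e e∈))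
  ... | inj₂ component = component

  component-lift : H' ⊆ H → (∀ f → f ∈ H → Conn G H x (src f) → f ∈ H') →
                   SingleVertexComponent G H' x ⊎ PathComponent G H' x →
                   SingleVertexComponent G H x ⊎ PathComponent G H x
  component-lift {H' = H'} {H = H} {x = x} H'⊆H closed = Sum.map isolated⁺ component⁺
    where
    restrict : Conn G H x y → Conn G H' x y
    restrict here                 = here
    restrict (fwd f f∈ c tgt≡y) = fwd f (closed f f∈ c) (restrict c) tgt≡y
    restrict (bwd f f∈ c src≡y) = bwd f (closed f f∈ (bwd f f∈ c refl)) (restrict c) src≡y

    isolated⁺ : SingleVertexComponent G H' x → SingleVertexComponent G H x
    isolated⁺ isolated f f∈ =
        (λ { refl → proj₁ (isolated f (closed f f∈ here)) refl })
      , (λ { refl → proj₂ (isolated f (closed f f∈ (bwd f f∈ here refl))) refl })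

    component⁺ : PathComponent G H' x → PathComponent G H x
    component⁺ (P , covers , connected , edges) =
        SimplePath-mono H'⊆H P
      , (λ y c → covers y (restrict c))
      , (λ i → Conn-mono H'⊆H (connected i))
      , (λ f f∈ c → edges f (closed f f∈ c) (restrict c))

  InDegree≤1 OutDegree≤1 : Subset m → Set
  InDegree≤1 H  = InjectiveOn H tgt
  OutDegree≤1 H = InjectiveOn H src

  HasPredecessor : Subset m → Fin m → Set
  HasPredecessor H g = ∃ λ h → h ∈ H × tgt h ≡ src g

  hasPredecessor? : ∀ H g → Dec (HasPredecessor H g)
  hasPredecessor? H g = any? λ h → h ∈? H ×-dec tgt h ≟ src g

  PredecessorClosed : Subset m → Set
  PredecessorClosed S = ∀ g → g ∈ S → HasPredecessor S g

  -- Following predecessors backwards inside a finite edge set must repeat, so a nonempty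
  -- predecessor-closed edge set is the same thing as one containing a directed cycle.
  Acyclic : Subset m → Set
  Acyclic H = ∀ S → S ⊆ H → Nonempty S → ¬ PredecessorClosed S

  Acyclic-antimono : H' ⊆ H → Acyclic H → Acyclic H'
  Acyclic-antimono H'⊆H acyclic S S⊆H' = acyclic S (λ x∈ → H'⊆H (S⊆H' x∈))

  NoLoop : Subset m → Set
  NoLoop H = ∀ f → f ∈ H → src f ≢ tgt f

  loop⊎noLoop : ∀ H → (∃ λ ℓ → ℓ ∈ H × src ℓ ≡ tgt ℓ) ⊎ NoLoop H
  loop⊎noLoop H with any? (λ ℓ → ℓ ∈? H ×-dec src ℓ ≟ tgt ℓ)
  ... | yes loop   = inj₁ loop
  ... | no noLoops = inj₂ λ f f∈ loop → noLoops (f , f∈ , loop)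

  predecessor∈ : InDegree≤1 H → S ⊆ H → PredecessorClosed S →
                 ∀ {g h} → g ∈ S → h ∈ H → tgt h ≡ src g → h ∈ S
  predecessor∈ inDeg S⊆H closed {g} {h} g∈ h∈ h↦g with h' , h'∈ , h'↦g ← closed g g∈ =
    subst (_∈ _) (inDeg h' h (S⊆H h'∈) h∈ (trans h'↦g (sym h↦g))) h'∈

  multipath⇒inDegree≤1 : IsMultipath G H → InDegree≤1 H
  multipath⇒inDegree≤1 mp a b a∈ b∈ tgt≡
    with (P , _ , _ , edges) ← tgt-component mp a∈
    with edges a a∈ (bwd a a∈ here refl) | edges b b∈ (bwd b b∈ (subst (Conn G _ _) tgt≡ here) refl)
  ... | i , refl | j , refl = cong (edge P) (suc-injective (noRepeat P tgt≡))

  multipath⇒outDegree≤1 : IsMultipath G H → OutDegree≤1 H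
  multipath⇒outDegree≤1 mp a b a∈ b∈ src≡
    with (P , _ , _ , edges) ← src-component mp a∈
    with edges a a∈ here | edges b b∈ (subst (Conn G _ _) src≡ here)
  ... | i , refl | j , refl =
    cong (edge P) (inject₁-injective (noRepeat P
      (trans (sym (src-edge P i)) (trans src≡ (src-edge P j)))))

  predecessorClosed⇒¬multipath : Nonempty S → PredecessorClosed S → ¬ IsMultipath G S
  predecessorClosed⇒¬multipath (f , f∈) closed mp
    with component@(P , _) ← src-component mp f∈
    with h , h∈ , h↦start ← closed (edge P zero) (inH P zero)
    = no-edge-into-start component h h∈ h↦start

  empty⇒multipath : Empty H → IsMultipath G H
  empty⇒multipath empty v = inj₁ λ f f∈ → contradiction (f , f∈) empty

  acyclic⇒empty⊎initialEdge : Acyclic H → Empty H ⊎ ∃ λ e → e ∈ H × ¬ HasPredecessor H e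
  acyclic⇒empty⊎initialEdge {H = H} acyclic
    with any? (λ e → e ∈? H ×-dec ¬? (hasPredecessor? H e))
  ... | yes initial = inj₂ initial
  ... | no noInitial = inj₁ λ nonempty → acyclic H (λ x∈ → x∈) nonempty λ g g∈ →
    decidable-stable (hasPredecessor? H g) λ noPred → noInitial (g , g∈ , noPred)

  -- Since e has no predecessor, the component of src e in H is e followed by the component of
  -- tgt e in H - e, and every other component of H is one of H - e.
  module Prepend {H e} (e∈ : e ∈ H) (noPred : ¬ HasPredecessor H e)
                 (inDeg : InDegree≤1 H) (outDeg : OutDegree≤1 H) (mp : IsMultipath G (H - e)) where

    private
      H⁻ = H - e
      u  = src e
      w  = tgt e

    ∈H⁻ : ∀ {f} → f ∈ H → f ≢ e → f ∈ H⁻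
    ∈H⁻ = x∈p∧x≢y⇒x∈p-y

    H⁻⊆H : H⁻ ⊆ H
    H⁻⊆H = p-x⊆p

    u-isolated : SingleVertexComponent G H⁻ u
    u-isolated f f∈ =
        (λ src≡u → x∈p-y⇒x≢y f∈ (outDeg f e (H⁻⊆H f∈) e∈ src≡u))
      , (λ tgt≡u → noPred (f , H⁻⊆H f∈ , tgt≡u))

    Conn-split : Conn G H u y → u ≡ y ⊎ Conn G H⁻ w y
    Conn-split here = inj₁ refl
    Conn-split (fwd f f∈ c tgt≡y) with f ≟ e | Conn-split c
    ... | yes refl | _        = inj₂ (subst (Conn G H⁻ w) tgt≡y here)
    ... | no f≢e   | inj₁ u≡src = contradiction (sym u≡src) (proj₁ (u-isolated f (∈H⁻ f∈ f≢e)))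
    ... | no f≢e   | inj₂ c⁻  = inj₂ (fwd f (∈H⁻ f∈ f≢e) c⁻ tgt≡y)
    Conn-split (bwd f f∈ c src≡y) with f ≟ e | Conn-split c
    ... | yes refl | _        = inj₁ src≡y
    ... | no f≢e   | inj₁ u≡tgt = contradiction (f , f∈ , sym u≡tgt) noPred
    ... | no f≢e   | inj₂ c⁻  = inj₂ (bwd f (∈H⁻ f∈ f≢e) c⁻ src≡y)

    Conn-join : Conn G H⁻ w y → Conn G H u y
    Conn-join c = Conn-trans (fwd e e∈ here refl) (Conn-mono H⁻⊆H c)

    edge-split : ∀ {f} → f ∈ H → f ≢ e → Conn G H u (src f) → Conn G H⁻ w (src f)
    edge-split f∈ f≢e c with Conn-split c
    ... | inj₁ u≡src = contradiction (outDeg _ e f∈ e∈ (sym u≡src)) f≢e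
    ... | inj₂ c⁻    = c⁻

    u-component-of-isolated : SingleVertexComponent G H⁻ w → PathComponent G H u
    u-component-of-isolated w-isolated = edgePath e∈ nonLoop-e , covers , connected , edges
      where
      nonLoop-e : u ≢ w
      nonLoop-e u≡w = noPred (e , e∈ , sym u≡w)
      covers : ∀ y → Conn G H u y → ∃ λ i → pathVert G (λ _ → e) i ≡ y
      covers y c with Conn-split c
      ... | inj₁ u≡y = zero , u≡y
      ... | inj₂ c⁻  = suc zero , isolated-Conn⇒≡ w-isolated c⁻
      connected : ∀ i → Conn G H u (pathVert G (λ _ → e) i)
      connected zero       = here
      connected (suc zero) = fwd e e∈ here refl
      edges : ∀ f → f ∈ H → Conn G H u (src f) → ∃ λ i → e ≡ f
      edges f f∈ c with f ≟ e
      ... | yes refl = zero , refl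
      ... | no f≢e   = contradiction (sym (isolated-Conn⇒≡ w-isolated (edge-split f∈ f≢e c)))
                                     (proj₁ (w-isolated f (∈H⁻ f∈ f≢e)))

    u-component-of-path : PathComponent G H⁻ w → PathComponent G H u
    u-component-of-path (P , covers , connected , edges) = P⁺ , covers⁺ , connected⁺ , edges⁺
      where
      w-start : vert P zero ≡ w
      w-start with covers w here
      ... | zero  , eq = eq
      ... | suc j , eq = contradiction (inDeg _ e (H⁻⊆H (inH P j)) e∈ eq) (x∈p-y⇒x≢y (inH P j))
      u∉P : ∀ i → vert P i ≢ u
      u∉P i vᵢ≡u = noPred (e , e∈ , sym (isolated-Conn⇒≡ u-isolated
                     (Conn-sym (subst (Conn G H⁻ w) vᵢ≡u (connected i)))))
      P↑ = SimplePath-mono H⁻⊆H P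
      P⁺ = consPath P↑ e∈ (sym w-start) u∉P
      vert-P⁺ : ∀ i → vert P⁺ (suc i) ≡ vert P i
      vert-P⁺ = vert-consPath P↑ e∈ (sym w-start) u∉P
      covers⁺ : ∀ y → Conn G H u y → ∃ λ i → vert P⁺ i ≡ y
      covers⁺ y c with Conn-split c
      ... | inj₁ u≡y = zero , u≡y
      ... | inj₂ c⁻ with i , eq ← covers y c⁻ = suc i , trans (vert-P⁺ i) eq
      connected⁺ : ∀ i → Conn G H u (vert P⁺ i)
      connected⁺ zero    = here
      connected⁺ (suc i) = subst (Conn G H u) (sym (vert-P⁺ i)) (Conn-join (connected i))
      edges⁺ : ∀ f → f ∈ H → Conn G H u (src f) → ∃ λ i → edge P⁺ i ≡ f
      edges⁺ f f∈ c with f ≟ e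
      ... | yes refl = zero , refl
      ... | no f≢e with i , eq ← edges f (∈H⁻ f∈ f≢e) (edge-split f∈ f≢e c) = suc i , eq

    multipath : IsMultipath G H
    multipath = assemble (Sum.[ u-component-of-isolated , u-component-of-path ]′ (mp w))
      where
      assemble : PathComponent G H u → IsMultipath G H
      assemble component@(P , covers , connected , _) x with any? (λ i → vert P i ≟ x)
      ... | yes (i , refl) = inj₂ (PathComponent-transport (connected i) component)
      ... | no x∉P = component-lift H⁻⊆H closed (mp x)
        where
        closed : ∀ f → f ∈ H → Conn G H x (src f) → f ∈ H⁻
        closed f f∈ c with f ≟ e
        ... | yes refl = contradiction (covers x (Conn-sym c)) x∉P
        ... | no f≢e   = ∈H⁻ f∈ f≢e

  degree≤1∧acyclic⇒multipath : InDegree≤1 H → OutDegree≤1 H → Acyclic H → IsMultipath G H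
  degree≤1∧acyclic⇒multipath {H = H} = go (⊂-wellFounded H)
    where
    go : ∀ {H} → Acc _⊂_ H → InDegree≤1 H → OutDegree≤1 H → Acyclic H → IsMultipath G H
    go (acc smaller) inDeg outDeg acyclic with acyclic⇒empty⊎initialEdge acyclic
    ... | inj₁ empty               = empty⇒multipath empty
    ... | inj₂ (e , e∈ , noPred) = Prepend.multipath e∈ noPred inDeg outDeg
      (go (smaller (x∈p⇒p-x⊂p e∈)) (InjectiveOn-antimono p-x⊆p inDeg)
          (InjectiveOn-antimono p-x⊆p outDeg) (Acyclic-antimono p-x⊆p acyclic))

  IsSinkSourceOrCycle : Subset m → Set
  IsSinkSourceOrCycle H =
    (IsLinearSinkPlusIsolated G H ⊎ IsLinearSourcePlusIsolated G H) ⊎ IsCoherentCyclePlusIsolated G H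

  module Minimal {H} (notMP : ¬ IsMultipath G H)
                 (minimal : ∀ H' → H' ⊆ H → ¬ IsMultipath G H' → H ⊆ H') where

    ⊇-predecessorClosed : S ⊆ H → Nonempty S → PredecessorClosed S → H ⊆ S
    ⊇-predecessorClosed S⊆H nonempty closed =
      minimal _ S⊆H (predecessorClosed⇒¬multipath nonempty closed)

    only-pair : ∀ {a b} → a ∈ H → b ∈ H → ¬ IsMultipath G (⁅ a ⁆ ∪ ⁅ b ⁆) →
                ∀ e → e ∈ H → e ≡ a ⊎ e ≡ b
    only-pair a∈ b∈ ¬mp e e∈ = ∈-⁅⁆∪⁅⁆⁻ (minimal _ (⁅⁆∪⁅⁆⊆ a∈ b∈) ¬mp e∈)

    loop-shape : ∀ {ℓ} → ℓ ∈ H → src ℓ ≡ tgt ℓ → IsCoherentCyclePlusIsolated G H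
    loop-shape {ℓ} ℓ∈ loop = inj₁ (ℓ , loop , ℓ∈ , λ e e∈ → x∈⁅y⁆⇒x≡y ℓ (H⊆⁅ℓ⁆ e∈))
      where
      closed : PredecessorClosed ⁅ ℓ ⁆
      closed g g∈ with refl ← x∈⁅y⁆⇒x≡y ℓ g∈ = ℓ , x∈⁅x⁆ ℓ , sym loop
      H⊆⁅ℓ⁆ = ⊇-predecessorClosed (⁅⁆⊆ ℓ∈) (ℓ , x∈⁅x⁆ ℓ) closed

    sink-shape : NoLoop H → ∀ {a b} → a ∈ H → b ∈ H → a ≢ b → tgt a ≡ tgt b →
                 IsLinearSinkPlusIsolated G H
    sink-shape noLoop {a} {b} a∈ b∈ a≢b tgt≡ =
        src a , tgt a , src b , a , b
      , noLoop a a∈ , (λ tgt≡src → noLoop b b∈ (trans (sym tgt≡src) tgt≡))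
      , (λ src≡ → a≢b (atMostOne a b (noLoop a a∈) src≡ tgt≡))
      , refl , refl , refl , sym tgt≡ , a∈ , b∈
      , only-pair a∈ b∈ λ mp → a≢b (multipath⇒inDegree≤1 mp a b (x∈⁅x⁆∪⁅y⁆ a b) (y∈⁅x⁆∪⁅y⁆ a b) tgt≡)

    source-shape : NoLoop H → ∀ {a b} → a ∈ H → b ∈ H → a ≢ b → src a ≡ src b →
                   IsLinearSourcePlusIsolated G H
    source-shape noLoop {a} {b} a∈ b∈ a≢b src≡ =
        tgt a , src a , tgt b , a , b
      , (λ tgt≡src → noLoop a a∈ (sym tgt≡src)) , (λ src≡tgt → noLoop b b∈ (trans (sym src≡) src≡tgt))
      , (λ tgt≡ → a≢b (atMostOne a b (noLoop a a∈) src≡ tgt≡))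
      , refl , refl , sym src≡ , refl , a∈ , b∈
      , only-pair a∈ b∈ λ mp → a≢b (multipath⇒outDegree≤1 mp a b (x∈⁅x⁆∪⁅y⁆ a b) (y∈⁅x⁆∪⁅y⁆ a b) src≡)

    module _ (noLoop : NoLoop H) (inDeg : InDegree≤1 H) (outDeg : OutDegree≤1 H) where

      multipath-minus : ∀ {e} → e ∈ H → IsMultipath G (H - e)
      multipath-minus {e} e∈ = degree≤1∧acyclic⇒multipath
        (InjectiveOn-antimono p-x⊆p inDeg) (InjectiveOn-antimono p-x⊆p outDeg) acyclic
        where
        acyclic : Acyclic (H - e)
        acyclic S S⊆ nonempty closed =
          x∈p-y⇒x≢y (S⊆ (⊇-predecessorClosed (λ x∈ → p-x⊆p (S⊆ x∈)) nonempty closed e∈)) refl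

      predecessorClosed : PredecessorClosed H
      predecessorClosed g g∈ = decidable-stable (hasPredecessor? H g) λ noPred →
        notMP (degree≤1∧acyclic⇒multipath inDeg outDeg λ S S⊆H nonempty closed →
          let h , h∈ , h↦g = closed g (⊇-predecessorClosed S⊆H nonempty closed g∈)
          in  noPred (h , S⊆H h∈ , h↦g))

      -- H - e is a multipath by minimality; the path component of src e in it, closed up by e,
      -- is predecessor-closed and hence all of H.
      cycle-through : ∀ {e f} → e ∈ H → f ∈ H - e → tgt f ≡ src e →
                      PathComponent G (H - e) (tgt f) → IsCoherentCyclePlusIsolated G H
      cycle-through {e} {f} e∈ f∈ f↦e component@(P , covers , connected , edges) =
        inj₂ ( len P , vert P , edge P , e , noRepeat P
             , (λ i → src-edge P i , refl , p-x⊆p (inH P i))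
             , sym e-from-end , sym e-to-start , e∈ , covered)
        where
        e-from-end : vert P (fromℕ (suc (len P))) ≡ src e
        e-from-end with j , vⱼ≡ ← covers (tgt f) here with fromℕ⊎inject₁ j
        ... | inj₁ refl       = trans vⱼ≡ f↦e
        ... | inj₂ (i , refl) =
          contradiction (outDeg _ e (p-x⊆p (inH P i)) e∈ (trans (src-edge P i) (trans vⱼ≡ f↦e)))
                        (x∈p-y⇒x≢y (inH P i))

        e-to-start : vert P zero ≡ tgt e
        e-to-start with h , h∈ , h↦start ← predecessorClosed (edge P zero) (p-x⊆p (inH P zero))
                   with h ≟ e
        ... | yes refl = sym h↦start
        ... | no h≢e   = contradiction h↦start (no-edge-into-start component h (x∈p∧x≢y⇒x∈p-y h∈ h≢e))

        C = image (edge P) ∪ ⁅ e ⁆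

        e∈C : e ∈ C
        e∈C = x∈p∪q⁺ (inj₂ (x∈⁅x⁆ e))

        edge∈C : ∀ i → edge P i ∈ C
        edge∈C i = x∈p∪q⁺ (inj₁ (f∈image (edge P) i))

        C⊆H : C ⊆ H
        C⊆H x∈ with x∈p∪q⁻ (image (edge P)) ⁅ e ⁆ x∈
        ... | inj₁ x∈P with i , refl ← ∈-image⁻ (edge P) x∈P = p-x⊆p (inH P i)
        ... | inj₂ x∈e = subst (_∈ H) (sym (x∈⁅y⁆⇒x≡y e x∈e)) e∈

        closed : PredecessorClosed C
        closed g g∈ with x∈p∪q⁻ (image (edge P)) ⁅ e ⁆ g∈
        ... | inj₂ g∈e with refl ← x∈⁅y⁆⇒x≡y e g∈e
                       with i , refl ← edges f f∈ (bwd f f∈ here refl)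
                       = edge P i , edge∈C i , f↦e
        ... | inj₁ g∈P with ∈-image⁻ (edge P) g∈P
        ...   | zero  , refl = e , e∈C , sym e-to-start
        ...   | suc i , refl = edge P (inject₁ i) , edge∈C (inject₁ i) , consec P i

        covered : ∀ x → x ∈ H → (∃ λ i → edge P i ≡ x) ⊎ x ≡ e
        covered x x∈ = Sum.map (∈-image⁻ (edge P)) (x∈⁅y⁆⇒x≡y e)
          (x∈p∪q⁻ _ _ (⊇-predecessorClosed C⊆H (e , e∈C) closed x∈))

      cycle-shape : IsCoherentCyclePlusIsolated G H
      cycle-shape
        with e , e∈ ← decidable-stable (nonempty? H) (λ empty → notMP (empty⇒multipath empty))
        with f , f∈ , f↦e ← predecessorClosed e e∈
        = cycle-through e∈ f∈⁻ f↦e (tgt-component (multipath-minus e∈) f∈⁻)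
        where
        f∈⁻ : f ∈ H - e
        f∈⁻ = x∈p∧x≢y⇒x∈p-y f∈ λ { refl → noLoop e e∈ (sym f↦e) }

    shape : IsSinkSourceOrCycle H
    shape with loop⊎noLoop H | injectiveOn⊎collision H tgt | injectiveOn⊎collision H src
    ... | inj₁ (ℓ , ℓ∈ , loop) | _ | _ = inj₂ (loop-shape ℓ∈ loop)
    ... | inj₂ noLoop | inj₂ (a , b , a∈ , b∈ , a≢b , tgt≡) | _ =
      inj₁ (inj₁ (sink-shape noLoop a∈ b∈ a≢b tgt≡))
    ... | inj₂ noLoop | inj₁ _ | inj₂ (a , b , a∈ , b∈ , a≢b , src≡) =
      inj₁ (inj₂ (source-shape noLoop a∈ b∈ a≢b src≡))
    ... | inj₂ noLoop | inj₁ inDeg | inj₁ outDeg = inj₂ (cycle-shape noLoop inDeg outDeg)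

  ProperSubgraphsMultipath : Subset m → Set
  ProperSubgraphsMultipath H = ∀ H' → H' ⊆ H → ∀ {g} → g ∈ H → g ∉ H' → IsMultipath G H'

  minimal-if-properSubgraphsMultipath : ProperSubgraphsMultipath H →
                                        ∀ H' → H' ⊆ H → ¬ IsMultipath G H' → H ⊆ H'
  minimal-if-properSubgraphsMultipath proper H' H'⊆H ¬mp {g} g∈ =
    decidable-stable (g ∈? H') λ g∉ → ¬mp (proper H' H'⊆H g∈ g∉)

  subsingleton⇒multipath : (∀ a b → a ∈ H → b ∈ H → a ≡ b) → NoLoop H → IsMultipath G H
  subsingleton⇒multipath unique noLoop =
    degree≤1∧acyclic⇒multipath (λ a b a∈ b∈ _ → unique a b a∈ b∈) (λ a b a∈ b∈ _ → unique a b a∈ b∈)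
      acyclic
    where
    acyclic : Acyclic _
    acyclic S S⊆H (f , f∈) closed
      with h , h∈ , h↦f ← closed f f∈
      with refl ← unique h f (S⊆H h∈) (S⊆H f∈)
      = noLoop h (S⊆H h∈) (sym h↦f)

  loop-properSubgraphsMultipath : ∀ {ℓ} → (∀ e → e ∈ H → e ≡ ℓ) → ProperSubgraphsMultipath H
  loop-properSubgraphsMultipath only H' H'⊆H {g} g∈ g∉ = empty⇒multipath λ (f , f∈) →
    g∉ (subst (_∈ H') (trans (only f (H'⊆H f∈)) (sym (only g g∈))) f∈)

  pair-properSubgraphsMultipath : ∀ {a b} → (∀ e → e ∈ H → e ≡ a ⊎ e ≡ b) →
                                  src a ≢ tgt a → src b ≢ tgt b → ProperSubgraphsMultipath H
  pair-properSubgraphsMultipath only a-nonLoop b-nonLoop H' H'⊆H {g} g∈ g∉ =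
    subsingleton⇒multipath unique noLoop
    where
    unique : ∀ x y → x ∈ H' → y ∈ H' → x ≡ y
    unique x y x∈ y∈ with only x (H'⊆H x∈) | only y (H'⊆H y∈) | only g g∈
    ... | inj₁ refl | inj₁ refl | _        = refl
    ... | inj₂ refl | inj₂ refl | _        = refl
    ... | inj₁ refl | inj₂ refl | inj₁ refl = contradiction x∈ g∉
    ... | inj₁ refl | inj₂ refl | inj₂ refl = contradiction y∈ g∉
    ... | inj₂ refl | inj₁ refl | inj₁ refl = contradiction y∈ g∉
    ... | inj₂ refl | inj₁ refl | inj₂ refl = contradiction x∈ g∉
    noLoop : NoLoop H'
    noLoop x x∈ with only x (H'⊆H x∈)
    ... | inj₁ refl = a-nonLoop
    ... | inj₂ refl = b-nonLoop

  module CoherentCycle {H k} {v : Fin (suc (suc k)) → Fin n} {p : Fin (suc k) → Fin m} {c}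
    (v-injective : Injective _≡_ _≡_ v)
    (p-edges : ∀ i → src (p i) ≡ v (inject₁ i) × tgt (p i) ≡ v (suc i) × p i ∈ H)
    (c-src : src c ≡ v (fromℕ (suc k))) (c-tgt : tgt c ≡ v zero) (c∈ : c ∈ H)
    (only : ∀ e → e ∈ H → (∃ λ i → p i ≡ e) ⊎ e ≡ c) where

    private
      p-src : ∀ i → src (p i) ≡ v (inject₁ i)
      p-src i = proj₁ (p-edges i)
      p-tgt : ∀ i → tgt (p i) ≡ v (suc i)
      p-tgt i = proj₁ (proj₂ (p-edges i))
      p∈ : ∀ i → p i ∈ H
      p∈ i = proj₂ (proj₂ (p-edges i))

    inDegree≤1 : InDegree≤1 H
    inDegree≤1 a b a∈ b∈ tgt≡ with only a a∈ | only b b∈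
    ... | inj₁ (i , refl) | inj₁ (j , refl) =
      cong p (suc-injective (v-injective (trans (sym (p-tgt i)) (trans tgt≡ (p-tgt j)))))
    ... | inj₁ (i , refl) | inj₂ refl =
      contradiction (v-injective (trans (sym c-tgt) (trans (sym tgt≡) (p-tgt i)))) 0≢1+n
    ... | inj₂ refl | inj₁ (j , refl) =
      contradiction (v-injective (trans (sym c-tgt) (trans tgt≡ (p-tgt j)))) 0≢1+n
    ... | inj₂ refl | inj₂ refl = refl

    outDegree≤1 : OutDegree≤1 H
    outDegree≤1 a b a∈ b∈ src≡ with only a a∈ | only b b∈
    ... | inj₁ (i , refl) | inj₁ (j , refl) =
      cong p (inject₁-injective (v-injective (trans (sym (p-src i)) (trans src≡ (p-src j)))))
    ... | inj₁ (i , refl) | inj₂ refl =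
      contradiction (v-injective (trans (sym c-src) (trans (sym src≡) (p-src i)))) fromℕ≢inject₁
    ... | inj₂ refl | inj₁ (j , refl) =
      contradiction (v-injective (trans (sym c-src) (trans src≡ (p-src j)))) fromℕ≢inject₁
    ... | inj₂ refl | inj₂ refl = refl

    -- Predecessors are unique, so S walks backwards around the whole cycle from any of its edges.
    ⊇-predecessorClosed : S ⊆ H → Nonempty S → PredecessorClosed S → H ⊆ S
    ⊇-predecessorClosed {S} S⊆H (f , f∈) closed {e} e∈ =
      Sum.[ (λ (i , pᵢ≡e) → subst (_∈ S) pᵢ≡e (p∈S i)) , (λ e≡c → subst (_∈ S) (sym e≡c) c∈S) ]′
        (only e e∈)
      where
      pred∈S : ∀ {g h} → g ∈ S → h ∈ H → tgt h ≡ src g → h ∈ S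
      pred∈S = predecessor∈ inDegree≤1 S⊆H closed

      p-step : ∀ i → p (suc i) ∈ S → p (inject₁ i) ∈ S
      p-step i p∈S = pred∈S p∈S (p∈ (inject₁ i)) (trans (p-tgt (inject₁ i)) (sym (p-src (suc i))))

      c∈S : c ∈ S
      c∈S with only f (S⊆H f∈)
      ... | inj₂ refl       = f∈
      ... | inj₁ (i , refl) = <-weakInduction (λ i → p i ∈ S → c ∈ S)
        (λ p₀∈S → pred∈S p₀∈S c∈ (trans c-tgt (sym (p-src zero))))
        (λ i down p∈S → down (p-step i p∈S)) i f∈

      p∈S : ∀ i → p i ∈ S
      p∈S = >-weakInduction (λ i → p i ∈ S)
        (pred∈S c∈S (p∈ (fromℕ k)) (trans (p-tgt (fromℕ k)) (sym c-src))) p-step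

    properSubgraphsMultipath : ProperSubgraphsMultipath H
    properSubgraphsMultipath H' H'⊆H g∈ g∉ = degree≤1∧acyclic⇒multipath
      (InjectiveOn-antimono H'⊆H inDegree≤1) (InjectiveOn-antimono H'⊆H outDegree≤1)
      λ S S⊆H' nonempty closed →
        g∉ (S⊆H' (⊇-predecessorClosed (λ x∈ → H'⊆H (S⊆H' x∈)) nonempty closed g∈))

  shape⇒properSubgraphsMultipath : IsSinkSourceOrCycle H → ProperSubgraphsMultipath H
  shape⇒properSubgraphsMultipath
    (inj₁ (inj₁ (_ , _ , _ , _ , _ , v₀≢v₁ , v₁≢v₂ , _ , refl , refl , refl , b↦v₁ , _ , _ , only))) =
    pair-properSubgraphsMultipath only v₀≢v₁ λ loop → v₁≢v₂ (sym (trans loop b↦v₁))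
  shape⇒properSubgraphsMultipath
    (inj₁ (inj₂ (_ , _ , _ , _ , _ , v₀≢v₁ , v₁≢v₂ , _ , refl , refl , v₁↦b , refl , _ , _ , only))) =
    pair-properSubgraphsMultipath only (λ loop → v₀≢v₁ (sym loop)) λ loop → v₁≢v₂ (trans (sym v₁↦b) loop)
  shape⇒properSubgraphsMultipath (inj₂ (inj₁ (_ , _ , _ , only))) =
    loop-properSubgraphsMultipath only
  shape⇒properSubgraphsMultipath
    (inj₂ (inj₂ (_ , _ , _ , _ , v-injective , p-edges , c-src , c-tgt , c∈ , only))) =
    CoherentCycle.properSubgraphsMultipath v-injective p-edges c-src c-tgt c∈ only

proposition4p8 : (G : Digraph) (H : SpanningSubgraph G) → ¬ IsMultipath G H →
    MinimalNonMultipath G H ⇔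
      ((IsLinearSinkPlusIsolated G H ⊎ IsLinearSourcePlusIsolated G H)
       ⊎ IsCoherentCyclePlusIsolated G H)
proposition4p8 G H notMP = mk⇔
  (λ (_ , minimal) → Minimal.shape G notMP minimal)
  (λ shape → notMP , minimal-if-properSubgraphsMultipath G (shape⇒properSubgraphsMultipath G shape))
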